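{- Let $P$ be a lattice with CLSP and let $Q$ be an order retract of $P$. Then $Q$ has CLSP.
   Context: $Q$ is an order retract of $P$ if there are order preserving maps $s:Q\to P$, $r:P\to Q$ with $r\circ s=\mathrm{id}_Q$ (such $Q$ is then a lattice). For a lattice $T$, $\mathcal{C}_L(T)$ is the set of nonempty convex sublattices of $T$ ordered by the bi-dominating order ($X\le Y$ iff every element of $X$ is below some element of $Y$ and every element of $Y$ is above some element of $X$); $T$ has CLSP if there is an order preserving $\varphi:\mathcal{C}_L(T)\to T$ with $\varphi(S)\in S$ for all $S$. -}

module Defs where

open import Level using (Level; _⊔_; suc)
open import Data.Product using (Σ; ∃; _×_; _,_)
open import Relation.Unary using (Pred; _∈_)
open import Relation.Binary.Definitions using (_Respects_)
open import Relation.Binary.Lattice.Bundles using (Lattice)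

record ConvexSublattice {c ℓ₁ ℓ₂} (T : Lattice c ℓ₁ ℓ₂) : Set (suc (c ⊔ ℓ₁ ⊔ ℓ₂)) where
  open Lattice T
  field
    subset    : Pred Carrier (c ⊔ ℓ₁ ⊔ ℓ₂)
    respects  : subset Respects _≈_
    nonempty  : ∃ λ x → x ∈ subset
    meet-closed : ∀ {x y} → x ∈ subset → y ∈ subset → (x ∧ y) ∈ subset
    join-closed : ∀ {x y} → x ∈ subset → y ∈ subset → (x ∨ y) ∈ subset
    convex    : ∀ {x y z} → x ∈ subset → z ∈ subset → x ≤ y → y ≤ z → y ∈ subset

_≤bd_ : ∀ {c ℓ₁ ℓ₂} {T : Lattice c ℓ₁ ℓ₂} →
        ConvexSublattice T → ConvexSublattice T → Set (c ⊔ ℓ₁ ⊔ ℓ₂)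
_≤bd_ {T = T} X Y =
  (∀ x → x ∈ ConvexSublattice.subset X → ∃ λ y → y ∈ ConvexSublattice.subset Y × x ≤ y)
  × (∀ y → y ∈ ConvexSublattice.subset Y → ∃ λ x → x ∈ ConvexSublattice.subset X × x ≤ y)
  where open Lattice T

CLSP : ∀ {c ℓ₁ ℓ₂} → Lattice c ℓ₁ ℓ₂ → Set (suc (c ⊔ ℓ₁ ⊔ ℓ₂))
CLSP T = Σ (ConvexSublattice T → Carrier) λ φ →
           (∀ S → φ S ∈ ConvexSublattice.subset S)
         × (∀ S S′ → S ≤bd S′ → φ S ≤ φ S′)
  where open Lattice T

IsOrderRetract : ∀ {c ℓ₁ ℓ₂} → Lattice c ℓ₁ ℓ₂ → Lattice c ℓ₁ ℓ₂ → Set (c ⊔ ℓ₁ ⊔ ℓ₂)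
IsOrderRetract Q P =
  Σ (Q.Carrier → P.Carrier) λ s → Σ (P.Carrier → Q.Carrier) λ r →
      (∀ {x y} → x Q.≤ y → s x P.≤ s y)
    × (∀ {x y} → x P.≤ y → r x Q.≤ r y)
    × (∀ q → r (s q) Q.≈ q)
  where module Q = Lattice Q
        module P = Lattice P

module Submission where

open import Defs
open import Data.Product using (_,_)
open import Level using (_⊔_)
open import Relation.Binary.Lattice.Bundles using (Lattice)
open import Relation.Unary using (_∈_)

-- Transport a convex sublattice S of Q to P as the convex hull of its image,
-- choose there with P's selection, and retract back: the retraction sends the
-- hull into the interval spanned by S, hence into S by convexity.

module ImageHull {c ℓ₁ ℓ₂} {P Q : Lattice c ℓ₁ ℓ₂}
                 (s : Lattice.Carrier Q → Lattice.Carrier P)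
                 (s-mono : ∀ {x y} → Lattice._≤_ Q x y → Lattice._≤_ P (s x) (s y)) where
  private
    module P = Lattice P
    module Q = Lattice Q
    module CS = ConvexSublattice

  record Between (S : ConvexSublattice Q) (y : P.Carrier) : Set (c ⊔ ℓ₁ ⊔ ℓ₂) where
    constructor between
    field
      {lower upper} : Q.Carrier
      lower∈ : lower ∈ CS.subset S
      upper∈ : upper ∈ CS.subset S
      above  : s lower P.≤ y
      below  : y P.≤ s upper

  image∈hull : ∀ S {a} → a ∈ CS.subset S → Between S (s a)
  image∈hull S a∈S = between a∈S a∈S P.refl P.refl

  hull : ConvexSublattice Q → ConvexSublattice P
  hull S = record
    { subset      = Between S
    ; respects    = λ { x≈y (between l∈ u∈ l≤x x≤u) →
                        between l∈ u∈ (P.trans l≤x (P.reflexive x≈y)) (P.≤-respˡ-≈ x≈y x≤u) }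
    ; nonempty    = let (a , a∈S) = CS.nonempty S in s a , image∈hull S a∈S
    ; meet-closed = λ { (between {l₁} l₁∈ u₁∈ l₁≤x x≤u₁) (between {l₂} l₂∈ _ l₂≤y _) →
                        between (CS.meet-closed S l₁∈ l₂∈) u₁∈
                          (P.∧-greatest (P.trans (s-mono (Q.x∧y≤x l₁ l₂)) l₁≤x)
                                        (P.trans (s-mono (Q.x∧y≤y l₁ l₂)) l₂≤y))
                          (P.trans (P.x∧y≤x _ _) x≤u₁) }
    ; join-closed = λ { (between {_} {u₁} l₁∈ u₁∈ l₁≤x x≤u₁) (between {_} {u₂} _ u₂∈ _ y≤u₂) →
                        between l₁∈ (CS.join-closed S u₁∈ u₂∈)
                          (P.trans l₁≤x (P.x≤x∨y _ _))
                          (P.∨-least (P.trans x≤u₁ (s-mono (Q.x≤x∨y u₁ u₂)))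
                                     (P.trans y≤u₂ (s-mono (Q.y≤x∨y u₁ u₂)))) }
    ; convex      = λ { (between l∈ _ l≤x _) (between _ u∈ _ z≤u) x≤y y≤z →
                        between l∈ u∈ (P.trans l≤x x≤y) (P.trans y≤z z≤u) }
    }

  hull-mono : ∀ {S T} → S ≤bd T → hull S ≤bd hull T
  hull-mono {S} {T} (dominated , dominating) =
      (λ { y (between _ u∈S _ y≤u) →
           let (u′ , u′∈T , u≤u′) = dominated _ u∈S
           in s u′ , image∈hull T u′∈T , P.trans y≤u (s-mono u≤u′) })
    , (λ { y (between l∈T _ l≤y _) →
           let (l′ , l′∈S , l′≤l) = dominating _ l∈T
           in s l′ , image∈hull S l′∈S , P.trans (s-mono l′≤l) l≤y })

  retract-hull⊆ : (r : P.Carrier → Q.Carrier) → (∀ {x y} → x P.≤ y → r x Q.≤ r y) →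
                  (∀ q → r (s q) Q.≈ q) → ∀ S {y} → Between S y → r y ∈ CS.subset S
  retract-hull⊆ r r-mono r∘s≈id S (between {l} {u} l∈ u∈ l≤y y≤u) =
    CS.convex S l∈ u∈ (Q.≤-respˡ-≈ (r∘s≈id l) (r-mono l≤y))
                      (Q.≤-respʳ-≈ (r∘s≈id u) (r-mono y≤u))

mainTheorem13 : ∀ {c ℓ₁ ℓ₂} (P Q : Lattice c ℓ₁ ℓ₂) →
                CLSP P → IsOrderRetract Q P → CLSP Q
mainTheorem13 P Q (φ , φ∈ , φ-mono) (s , r , s-mono , r-mono , r∘s≈id) =
    (λ S → r (φ (hull S)))
  , (λ S → retract-hull⊆ r r-mono r∘s≈id S (φ∈ (hull S)))
  , (λ S T S≤T → r-mono (φ-mono (hull S) (hull T) (hull-mono S≤T)))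
  where open ImageHull {P = P} {Q = Q} s s-mono
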